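{- For any honest function $f$, the number $\alpha^f$ is irrational.
   Context: A function is elementary if it can be generated from $2^x$, $\max$, $0$, successor and projections by composition and bounded primitive recursion; a relation is elementary if its characteristic function is. A function $f:\mathbb{N}\to\mathbb{N}$ is honest if $f(x)\le f(x+1)$, $f(x)\ge 2^x$ for all $x$, and the relation $f(x)=y$ is elementary. Let $P_i$ be the $i$-th prime ($P_0=2$). Define $g(0)=1$, $g(j+1)=P_j^{2(j+2)(g(j)+1)^3}$, $h(i)=g(f(i)+i)$, $\alpha^f_n=\sum_{i=0}^nP_i^{ -h(i)}$ and $\alpha^f=\lim_{n\to\infty}\alpha^f_n$. -}

module Defs where

open import Data.Nat as ℕ using (ℕ; zero; suc; _+_; _*_; _^_; _≤_; _⊔_; _≟_; _!)
open import Data.Nat.Properties using (m^n≢0)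
open import Data.Nat.Primality using (prime?)

open import Data.Fin using (Fin)
open import Data.Vec using (Vec; []; _∷_; lookup; head; tabulate)
open import Data.Integer using (+_)
open import Data.Rational as ℚ using (ℚ; 0ℚ; _-_; ∣_∣; _<_)
open import Data.Product using (∃; _×_)
open import Data.Bool using (if_then_else_)
open import Relation.Nullary using (does)
open import Relation.Binary.PropositionalEquality using (_≡_)

rec : ∀ {k} → (Vec ℕ k → ℕ) → (Vec ℕ (suc (suc k)) → ℕ) → Vec ℕ k → ℕ → ℕ
rec g h xs zero    = g xs
rec g h xs (suc y) = h (y ∷ rec g h xs y ∷ xs)

recF : ∀ {k} → (Vec ℕ k → ℕ) → (Vec ℕ (suc (suc k)) → ℕ) → Vec ℕ (suc k) → ℕ
recF g h (y ∷ xs) = rec g h xs y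

data Elem : (k : ℕ) → (Vec ℕ k → ℕ) → Set where
  zeroE : Elem 0 (λ _ → 0)
  sucE  : Elem 1 (λ xs → suc (head xs))
  expE  : Elem 1 (λ xs → 2 ^ head xs)
  maxE  : Elem 2 (λ xs → lookup xs Fin.zero ⊔ lookup xs (Fin.suc Fin.zero))
  projE : ∀ {k} (i : Fin k) → Elem k (λ xs → lookup xs i)
  compE : ∀ {k m} {h : Vec ℕ m → ℕ} {gs : Fin m → Vec ℕ k → ℕ} →
          Elem m h → (∀ i → Elem k (gs i)) →
          Elem k (λ xs → h (tabulate (λ i → gs i xs)))
  brecE : ∀ {k} {g : Vec ℕ k → ℕ} {h : Vec ℕ (suc (suc k)) → ℕ} {b : Vec ℕ (suc k) → ℕ} →
          Elem k g → Elem (suc (suc k)) h → Elem (suc k) b →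
          (∀ xs → recF g h xs ≤ b xs) →
          Elem (suc k) (recF g h)
  -- the class is a class of functions: closed under extensional equality
  extE  : ∀ {k} {f f' : Vec ℕ k → ℕ} → Elem k f → (∀ xs → f xs ≡ f' xs) → Elem k f'

graphχ : (ℕ → ℕ) → Vec ℕ 2 → ℕ
graphχ f (x ∷ y ∷ []) = if does (f x ≟ y) then 1 else 0

record Honest (f : ℕ → ℕ) : Set where
  field
    mono   : ∀ x → f x ≤ f (suc x)
    big    : ∀ x → 2 ^ x ≤ f x
    graphE : Elem 2 (graphχ f)

-- search n fuel: predecessor of the least prime among n+1, ..., n+fuel
-- (fallback n if none, which never happens for the fuel used below)
search : ℕ → ℕ → ℕ
search n zero = n
search n (suc fuel) with does (prime? (suc n))
... | Data.Bool.true  = n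
... | Data.Bool.false = search (suc n) fuel

mutual
  Ppred : ℕ → ℕ
  Ppred zero    = 1
  Ppred (suc i) = search (P i) (suc (P i !))   -- Euclid: a prime lies in (p, p!+1]

  P : ℕ → ℕ
  P i = suc (Ppred i)

g : ℕ → ℕ
g zero    = 1
g (suc j) = P j ^ (2 * (j + 2) * (g j + 1) ^ 3)

hh : (ℕ → ℕ) → ℕ → ℕ
hh f i = g (f i + i)

term : (ℕ → ℕ) → ℕ → ℚ
term f i = (+ 1) ℚ./ (P i ^ hh f i) where instance _ = m^n≢0 (P i) (hh f i)

alpha : (ℕ → ℕ) → ℕ → ℚ
alpha f zero    = term f zero
alpha f (suc n) = alpha f n ℚ.+ term f (suc n)

ConvergesTo : (ℕ → ℚ) → ℚ → Set
ConvergesTo s r = ∀ (ε : ℚ) → 0ℚ < ε → ∃ λ N → ∀ n → N ≤ n → ∣ s n - r ∣ < ε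

-- Write E_i = P_i^{h(i)} for the denominator of the i-th term. Since 2 E_i ≤ E_{i+1},
-- the tail after α_n is at most 2/E_{n+1}, so α_n < α ≤ α_n + 2/E_{n+1}. The unreduced
-- denominator of α_n is ∏_{i≤n} E_i ≤ E_n^{n+1}; hence if α = a/b then
-- α - α_n ≥ 1/(b E_n^{n+1}), i.e. E_{n+1} ≤ 2 b E_n^{n+1}. Taking n = b contradicts
-- 2 n E_n^{n+1} < E_{n+1}, which holds because, with j = f(n) + n, the left side is at most
-- g(j+1) = P_j^{2(j+2)(g(j)+1)^3} while E_{n+1} ≥ 2^{g(j+1)}.
module Submission where

open import Defs
open import Data.Nat
open import Data.Nat.Properties
open import Data.Nat.Primality using (prime?)
open import Data.Bool using (true; false)
open import Data.Integer as ℤ using (+_; -[1+_])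
import Data.Integer.Properties as ℤₚ
import Data.Integer.Tactic.RingSolver as ℤ-Solver
open import Data.Rational as ℚ using (ℚ; mkℚ; 0ℚ; toℚᵘ)
import Data.Rational.Properties as ℚₚ
open import Data.Rational.Solver using (module +-*-Solver)
open import Data.Rational.Unnormalised as ℚᵘ using (ℚᵘ; mkℚᵘ; *≤*; *<*; *≡*; ↧ₙ_)
import Data.Rational.Unnormalised.Properties as ℚᵘₚ
import Data.Rational.Unnormalised.Solver as ℚᵘ-Solver
open import Data.Product using (∃-syntax; _×_; _,_)
open import Function using (flip; case_of_)
open import Relation.Binary.Core using (Rel)
open import Relation.Binary.Definitions using (Reflexive; Transitive)
open import Relation.Binary.PropositionalEquality
  using (_≡_; refl; sym; trans; cong; subst; subst₂)
open import Relation.Nullary using (¬_; does)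

n<2^n : ∀ n → n < 2 ^ n
n<2^n zero    = z<s
n<2^n (suc n) = begin-strict
  suc n          ≤⟨ n<2^n n ⟩
  2 ^ n          <⟨ m<m+n (2 ^ n) (m^n>0 2 n) ⟩
  2 ^ n + 2 ^ n  ≡⟨ cong (λ k → 2 ^ n + k) (+-identityʳ (2 ^ n)) ⟨
  2 ^ suc n      ∎
  where open ≤-Reasoning

m≤m^[1+n] : ∀ m n → m ≤ m ^ suc n
m≤m^[1+n] zero    n = z≤n
m≤m^[1+n] (suc m) n = m≤m*n (suc m) (suc m ^ n) {{m^n≢0 (suc m) n}}

suc-mono⇒mono : ∀ {a ℓ} {A : Set a} (_≼_ : Rel A ℓ) → Reflexive _≼_ → Transitive _≼_ →
                (F : ℕ → A) → (∀ x → F x ≼ F (suc x)) → ∀ {i j} → i ≤ j → F i ≼ F j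
suc-mono⇒mono _≼_ ≼-refl ≼-trans F step i≤j = go (≤⇒≤′ i≤j)
  where
  go : ∀ {i j} → i ≤′ j → F i ≼ F j
  go ≤′-refl        = ≼-refl
  go (≤′-step i≤′j) = ≼-trans (go i≤′j) (step _)

search-≥ : ∀ n fuel → n ≤ search n fuel
search-≥ n zero = ≤-refl
search-≥ n (suc fuel) with does (prime? (suc n))
... | true  = ≤-refl
... | false = ≤-trans (n≤1+n n) (search-≥ (suc n) fuel)

P-< : ∀ i → P i < P (suc i)
P-< i = s≤s (search-≥ (P i) (suc (P i !)))

P-mono : ∀ {i j} → i ≤ j → P i ≤ P j
P-mono = suc-mono⇒mono _≤_ ≤-refl ≤-trans P (λ i → <⇒≤ (P-< i))

2≤P : ∀ i → 2 ≤ P i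
2≤P i = P-mono {0} {i} z≤n

g-< : ∀ j → g j < g (suc j)
g-< j = begin-strict
  g j            <⟨ m<m+n (g j) z<s ⟩
  g j + 1        ≤⟨ m≤m^[1+n] (g j + 1) 2 ⟩
  (g j + 1) ^ 3  ≤⟨ m≤n*m _ (2 * (j + 2)) {{m*n≢0 2 (j + 2) {{_}} {{≢-nonZero (m+1+n≢0 j)}}}} ⟩
  K              <⟨ n<2^n K ⟩
  2 ^ K          ≤⟨ ^-monoˡ-≤ K (2≤P j) ⟩
  g (suc j)      ∎
  where
  open ≤-Reasoning
  K = 2 * (j + 2) * (g j + 1) ^ 3

g-mono : ∀ {i j} → i ≤ j → g i ≤ g j
g-mono = suc-mono⇒mono _≤_ ≤-refl ≤-trans g (λ j → <⇒≤ (g-< j))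

E : (ℕ → ℕ) → ℕ → ℕ
E f i = P i ^ hh f i

E-nonZero : ∀ f i → NonZero (E f i)
E-nonZero f i = m^n≢0 (P i) (hh f i)

module _ {f : ℕ → ℕ} (f-step : ∀ x → f x ≤ f (suc x)) where

  index-suc : ∀ n → suc (f n + n) ≤ f (suc n) + suc n
  index-suc n rewrite +-suc (f (suc n)) n = s≤s (+-monoˡ-≤ n (f-step n))

  hh-< : ∀ n → hh f n < hh f (suc n)
  hh-< n = <-≤-trans (g-< (f n + n)) (g-mono (index-suc n))

  E-double : ∀ i → 2 * E f i ≤ E f (suc i)
  E-double i = begin
    2 * P i ^ h          ≤⟨ *-monoˡ-≤ (P i ^ h) (2≤P (suc i)) ⟩
    P (suc i) * P i ^ h  ≤⟨ *-monoʳ-≤ (P (suc i)) (^-monoˡ-≤ h (<⇒≤ (P-< i))) ⟩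
    P (suc i) ^ suc h    ≤⟨ ^-monoʳ-≤ (P (suc i)) (hh-< i) ⟩
    E f (suc i)          ∎
    where
    open ≤-Reasoning
    h = hh f i

  E-mono : ∀ {i j} → i ≤ j → E f i ≤ E f j
  E-mono = suc-mono⇒mono _≤_ ≤-refl ≤-trans (E f) (λ i → ≤-trans (m≤n*m (E f i) 2) (E-double i))

  2*n*E^[1+n]<E[1+n] : ∀ n → 2 * n * E f n ^ suc n < E f (suc n)
  2*n*E^[1+n]<E[1+n] n = begin-strict
    2 * n * E f n ^ suc n        ≤⟨ *-mono-≤ 2*n≤p^[1+n] (^-monoˡ-≤ (suc n) E[n]≤p^H) ⟩
    p ^ suc n * (p ^ H) ^ suc n  ≡⟨ cong (p ^ suc n *_) (^-*-assoc p H (suc n)) ⟩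
    p ^ suc n * p ^ (H * suc n)  ≡⟨ ^-distribˡ-+-* p (suc n) (H * suc n) ⟨
    p ^ (suc H * suc n)          ≤⟨ ^-monoʳ-≤ p exponent-bound ⟩
    g (suc j)                    <⟨ n<2^n (g (suc j)) ⟩
    2 ^ g (suc j)                ≤⟨ ^-monoʳ-≤ 2 (g-mono (index-suc n)) ⟩
    2 ^ hh f (suc n)             ≤⟨ ^-monoˡ-≤ (hh f (suc n)) (2≤P (suc n)) ⟩
    E f (suc n)                  ∎
    where
    open ≤-Reasoning
    j = f n + n
    H = g j
    p = P j
    E[n]≤p^H : E f n ≤ p ^ H
    E[n]≤p^H = ^-monoˡ-≤ H (P-mono (m≤n+m n (f n)))
    2*n≤p^[1+n] : 2 * n ≤ p ^ suc n
    2*n≤p^[1+n] = ≤-trans (*-monoʳ-≤ 2 (<⇒≤ (n<2^n n))) (^-monoˡ-≤ (suc n) (2≤P j))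
    1+H≤[H+1]^3 : suc H ≤ (H + 1) ^ 3
    1+H≤[H+1]^3 = ≤-trans (≤-reflexive (+-comm 1 H)) (m≤m^[1+n] (H + 1) 2)
    1+n≤2*[j+2] : suc n ≤ 2 * (j + 2)
    1+n≤2*[j+2] = ≤-trans (s≤s (≤-trans (m≤n+m n (f n)) (n≤1+n j)))
                          (≤-trans (≤-reflexive (+-comm 2 j)) (m≤n*m (j + 2) 2))
    -- the right-hand side is the exponent in the definition of g (suc j)
    exponent-bound : suc H * suc n ≤ 2 * (j + 2) * (H + 1) ^ 3
    exponent-bound = begin
      suc H * suc n              ≡⟨ *-comm (suc H) (suc n) ⟩
      suc n * suc H              ≤⟨ *-mono-≤ 1+n≤2*[j+2] 1+H≤[H+1]^3 ⟩
      2 * (j + 2) * (H + 1) ^ 3  ∎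

/-mono-≤ : ∀ a b c d .{{_ : NonZero b}} .{{_ : NonZero d}} →
           a * d ≤ c * b → + a ℚᵘ./ b ℚᵘ.≤ + c ℚᵘ./ d
/-mono-≤ a (suc b) c (suc d) ad≤cb =
  *≤* (subst₂ ℤ._≤_ (ℤₚ.pos-* a (suc d)) (ℤₚ.pos-* c (suc b)) (ℤ.+≤+ ad≤cb))

/-cancel-≤ : ∀ a b c d .{{_ : NonZero b}} .{{_ : NonZero d}} →
             + a ℚᵘ./ b ℚᵘ.≤ + c ℚᵘ./ d → a * d ≤ c * b
/-cancel-≤ a (suc b) c (suc d) (*≤* le) =
  ℤₚ.drop‿+≤+ (subst₂ ℤ._≤_ (sym (ℤₚ.pos-* a (suc d))) (sym (ℤₚ.pos-* c (suc b))) le)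

1/d+1/d≃2/d : ∀ d .{{_ : NonZero d}} → + 1 ℚᵘ./ d ℚᵘ.+ + 1 ℚᵘ./ d ℚᵘ.≃ + 2 ℚᵘ./ d
1/d+1/d≃2/d (suc d-1) = *≡* (ring-identity (+ suc d-1))
  where
  ring-identity : ∀ d → (+ 1 ℤ.* d ℤ.+ + 1 ℤ.* d) ℤ.* d ≡ + 2 ℤ.* (d ℤ.* d)
  ring-identity = ℤ-Solver.solve-∀

<⇒1≤- : ∀ {i j} → i ℤ.< j → + 1 ℤ.≤ j ℤ.- i
<⇒1≤- {i} {j} i<j = begin
  + 1              ≡⟨ 1≡1+i-i i ⟩
  + 1 ℤ.+ i ℤ.- i  ≤⟨ ℤₚ.+-monoˡ-≤ (ℤ.- i) (ℤₚ.i<j⇒suc[i]≤j i<j) ⟩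
  j ℤ.- i          ∎
  where
  open ℤₚ.≤-Reasoning
  1≡1+i-i : ∀ x → + 1 ≡ + 1 ℤ.+ x ℤ.- x
  1≡1+i-i = ℤ-Solver.solve-∀

<⇒1/↧ₙ*↧ₙ≤- : ∀ {p q} → p ℚᵘ.< q → + 1 ℚᵘ./ (↧ₙ q * ↧ₙ p) ℚᵘ.≤ q ℚᵘ.- p
<⇒1/↧ₙ*↧ₙ≤- {mkℚᵘ a b-1} {mkℚᵘ c d-1} (*<* aD<cB) =
  -- cross-multiplied, the goal is 1 · D B ≤ (c B − a D) · B D, and c B − a D ≥ 1
  *≤* (ℤₚ.*-monoʳ-≤-nonNeg (+ (D * B)) 1≤cB-aD)
  where
  B = suc b-1
  D = suc d-1
  1≤cB-aD : + 1 ℤ.≤ c ℤ.* + B ℤ.+ ℤ.- a ℤ.* + D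
  1≤cB-aD = subst (λ k → + 1 ℤ.≤ c ℤ.* + B ℤ.+ k) (ℤₚ.neg-distribˡ-* a (+ D)) (<⇒1≤- aD<cB)

<∧-≤2/⇒≤2*↧ₙ*↧ₙ : ∀ {p q} y .{{_ : NonZero y}} →
                   p ℚᵘ.< q → q ℚᵘ.- p ℚᵘ.≤ + 2 ℚᵘ./ y →
                   y ≤ 2 * ↧ₙ q * ↧ₙ p
<∧-≤2/⇒≤2*↧ₙ*↧ₙ {p} {q} y p<q q-p≤2/y = begin
  y                    ≡⟨ *-identityˡ y ⟨
  1 * y                ≤⟨ /-cancel-≤ 1 (↧ₙ q * ↧ₙ p) 2 y 1/↧ₙq↧ₙp≤2/y ⟩
  2 * (↧ₙ q * ↧ₙ p)    ≡⟨ *-assoc 2 (↧ₙ q) (↧ₙ p) ⟨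
  2 * ↧ₙ q * ↧ₙ p      ∎
  where
  open ≤-Reasoning
  1/↧ₙq↧ₙp≤2/y : + 1 ℚᵘ./ (↧ₙ q * ↧ₙ p) ℚᵘ.≤ + 2 ℚᵘ./ y
  1/↧ₙq↧ₙp≤2/y = ℚᵘₚ.≤-trans (<⇒1/↧ₙ*↧ₙ≤- p<q) q-p≤2/y

↧ₙ-/ : ∀ i d .{{_ : NonZero d}} → ↧ₙ (i ℚᵘ./ d) ≡ d
↧ₙ-/ i (suc d-1) = refl

↧ₙ-+ : ∀ p q → ↧ₙ (p ℚᵘ.+ q) ≡ ↧ₙ p * ↧ₙ q
↧ₙ-+ (mkℚᵘ _ _) (mkℚᵘ _ _) = refl

toℚᵘ-/ : ∀ i d .{{_ : NonZero d}} → toℚᵘ (i ℚ./ d) ℚᵘ.≃ i ℚᵘ./ d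
toℚᵘ-/ i (suc d-1) = ℚₚ.toℚᵘ-fromℚᵘ (i ℚᵘ./ suc d-1)

1/-halving : ∀ d e .{{_ : NonZero d}} .{{_ : NonZero e}} →
             2 * d ≤ e → + 1 ℚ./ e ℚ.+ + 1 ℚ./ e ℚ.≤ + 1 ℚ./ d
1/-halving d e 2d≤e = ℚₚ.toℚᵘ-cancel-≤ (begin
  toℚᵘ (+ 1 ℚ./ e ℚ.+ + 1 ℚ./ e)         ≃⟨ ℚₚ.toℚᵘ-homo-+ (+ 1 ℚ./ e) (+ 1 ℚ./ e) ⟩
  toℚᵘ (+ 1 ℚ./ e) ℚᵘ.+ toℚᵘ (+ 1 ℚ./ e)  ≃⟨ ℚᵘₚ.+-cong (toℚᵘ-/ (+ 1) e) (toℚᵘ-/ (+ 1) e) ⟩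
  + 1 ℚᵘ./ e ℚᵘ.+ + 1 ℚᵘ./ e             ≃⟨ 1/d+1/d≃2/d e ⟩
  + 2 ℚᵘ./ e                             ≤⟨ /-mono-≤ 2 e 1 d (subst (2 * d ≤_) (sym (*-identityˡ e)) 2d≤e) ⟩
  + 1 ℚᵘ./ d                             ≃⟨ toℚᵘ-/ (+ 1) d ⟨
  toℚᵘ (+ 1 ℚ./ d)                       ∎)
  where open ℚᵘₚ.≤-Reasoning

p≤∣p∣ : ∀ p → p ℚ.≤ ℚ.∣ p ∣
p≤∣p∣ (mkℚ (+ _) _ _)       = ℚₚ.≤-refl
p≤∣p∣ p@(mkℚ -[1+ _ ] _ _) = ℚₚ.<⇒≤ (ℚₚ.neg<pos p ℚ.∣ p ∣)

∣p-q∣≡∣q-p∣ : ∀ p q → ℚ.∣ p ℚ.- q ∣ ≡ ℚ.∣ q ℚ.- p ∣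
∣p-q∣≡∣q-p∣ p q = trans (sym (ℚₚ.∣-p∣≡∣p∣ (p ℚ.- q))) (cong ℚ.∣_∣ (-[p-q]≡q-p p q))
  where
  open +-*-Solver
  -[p-q]≡q-p : ∀ p q → ℚ.- (p ℚ.- q) ≡ q ℚ.- p
  -[p-q]≡q-p = solve 2 (λ p q → :- (p :- q) := q :- p) refl

p<q⇒0<q-p : ∀ {p q} → p ℚ.< q → 0ℚ ℚ.< q ℚ.- p
p<q⇒0<q-p {p} {q} p<q = subst (ℚ._< q ℚ.- p) (ℚₚ.+-inverseʳ p) (ℚₚ.+-monoˡ-< (ℚ.- p) p<q)

0<q⇒p<p+q : ∀ {p q} → 0ℚ ℚ.< q → p ℚ.< p ℚ.+ q
0<q⇒p<p+q {p} {q} 0<q = subst (ℚ._< p ℚ.+ q) (ℚₚ.+-identityʳ p) (ℚₚ.+-monoʳ-< p 0<q)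

module _ {p q ε : ℚ} (∣p-q∣<ε : ℚ.∣ p ℚ.- q ∣ ℚ.< ε) where
  open +-*-Solver

  ∣p-q∣<ε⇒p<q+ε : p ℚ.< q ℚ.+ ε
  ∣p-q∣<ε⇒p<q+ε = subst₂ ℚ._<_ (solve 2 (λ p q → (p :- q) :+ q := p) refl p q) (ℚₚ.+-comm ε q)
                                (ℚₚ.+-monoˡ-< q p-q<ε)
    where
    p-q<ε : p ℚ.- q ℚ.< ε
    p-q<ε = ℚₚ.≤-<-trans (p≤∣p∣ (p ℚ.- q)) ∣p-q∣<ε

  ∣p-q∣<ε⇒q-ε<p : q ℚ.- ε ℚ.< p
  ∣p-q∣<ε⇒q-ε<p = subst₂ ℚ._<_ (solve 3 (λ p q ε → (q :- p) :+ (p :- ε) := q :- ε) refl p q ε)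
                                (solve 2 (λ p ε → ε :+ (p :- ε) := p) refl p ε)
                                (ℚₚ.+-monoˡ-< (p ℚ.- ε) q-p<ε)
    where
    q-p<ε : q ℚ.- p ℚ.< ε
    q-p<ε = ℚₚ.≤-<-trans (p≤∣p∣ (q ℚ.- p)) (subst (ℚ._< ε) (∣p-q∣≡∣q-p∣ p q) ∣p-q∣<ε)

module _ {s : ℕ → ℚ} {r : ℚ} (s→r : ConvergesTo s r) where
  open +-*-Solver

  eventually-> : ∀ {v} → v ℚ.< r → ∀ n → ∃[ m ] n ≤ m × v ℚ.< s m
  eventually-> {v} v<r n with s→r (r ℚ.- v) (p<q⇒0<q-p v<r)
  ... | N , close = N ⊔ n , m≤n⊔m N n , subst (ℚ._< s (N ⊔ n)) r-[r-v]≡v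
                                          (∣p-q∣<ε⇒q-ε<p (close (N ⊔ n) (m≤m⊔n N n)))
    where
    r-[r-v]≡v : r ℚ.- (r ℚ.- v) ≡ v
    r-[r-v]≡v = solve 2 (λ r v → r :- (r :- v) := v) refl r v

  eventually-< : ∀ {u} → r ℚ.< u → ∀ n → ∃[ m ] n ≤ m × s m ℚ.< u
  eventually-< {u} r<u n with s→r (u ℚ.- r) (p<q⇒0<q-p r<u)
  ... | N , close = N ⊔ n , m≤n⊔m N n , subst (s (N ⊔ n) ℚ.<_) r+[u-r]≡u
                                          (∣p-q∣<ε⇒p<q+ε (close (N ⊔ n) (m≤m⊔n N n)))
    where
    r+[u-r]≡u : r ℚ.+ (u ℚ.- r) ≡ u
    r+[u-r]≡u = solve 2 (λ r u → r :+ (u :- r) := u) refl r u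

  limit-≤ : ∀ n {v} → (∀ m → n ≤ m → s m ℚ.≤ v) → r ℚ.≤ v
  limit-≤ n s≤v = ℚₚ.≮⇒≥ λ v<r → case eventually-> v<r n of λ where
    (m , n≤m , v<sm) → ℚₚ.<-irrefl refl (ℚₚ.<-≤-trans v<sm (s≤v m n≤m))

  limit-≥ : ∀ n {u} → (∀ m → n ≤ m → u ℚ.≤ s m) → u ℚ.≤ r
  limit-≥ n u≤s = ℚₚ.≮⇒≥ λ r<u → case eventually-< r<u n of λ where
    (m , n≤m , sm<u) → ℚₚ.<-irrefl refl (ℚₚ.<-≤-trans sm<u (u≤s m n≤m))

term-pos : ∀ f i → 0ℚ ℚ.< term f i
term-pos f i = ℚₚ.positive⁻¹ (term f i) {{ℚₚ.normalize-pos 1 (E f i) {{E-nonZero f i}}}}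

alpha-< : ∀ f n → alpha f n ℚ.< alpha f (suc n)
alpha-< f n = 0<q⇒p<p+q (term-pos f (suc n))

alpha-mono : ∀ f {n m} → n ≤ m → alpha f n ℚ.≤ alpha f m
alpha-mono f = suc-mono⇒mono ℚ._≤_ ℚₚ.≤-refl ℚₚ.≤-trans (alpha f) (λ n → ℚₚ.<⇒≤ (alpha-< f n))

termᵘ : (ℕ → ℕ) → ℕ → ℚᵘ
termᵘ f i = + 1 ℚᵘ./ E f i
  where instance _ = E-nonZero f i

-- Unnormalised addition does not cancel common factors, so the denominator of
-- alphaᵘ f n is the product of the E f i.
alphaᵘ : (ℕ → ℕ) → ℕ → ℚᵘ
alphaᵘ f zero    = termᵘ f zero
alphaᵘ f (suc n) = alphaᵘ f n ℚᵘ.+ termᵘ f (suc n)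

toℚᵘ-alpha : ∀ f n → toℚᵘ (alpha f n) ℚᵘ.≃ alphaᵘ f n
toℚᵘ-alpha f zero    = toℚᵘ-/ (+ 1) (E f zero) {{E-nonZero f zero}}
toℚᵘ-alpha f (suc n) =
  ℚᵘₚ.≃-trans (ℚₚ.toℚᵘ-homo-+ (alpha f n) (term f (suc n)))
              (ℚᵘₚ.+-cong (toℚᵘ-alpha f n) (toℚᵘ-/ (+ 1) (E f (suc n)) {{E-nonZero f (suc n)}}))

module _ {f : ℕ → ℕ} (f-step : ∀ x → f x ≤ f (suc x)) where

  term-halving : ∀ i → term f (suc i) ℚ.+ term f (suc i) ℚ.≤ term f i
  term-halving i =
    1/-halving (E f i) (E f (suc i)) {{E-nonZero f i}} {{E-nonZero f (suc i)}} (E-double f-step i)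

  alpha-tail : ∀ {n m} → n ≤ m → alpha f m ℚ.≤ alpha f n ℚ.+ (term f (suc n) ℚ.+ term f (suc n))
  alpha-tail {n} {m} n≤m = ℚₚ.≤-trans (ℚₚ.<⇒≤ alpha<bound) (bound-antitone n≤m)
    where
    bound : ℕ → ℚ
    bound k = alpha f k ℚ.+ (term f (suc k) ℚ.+ term f (suc k))
    bound-step : ∀ k → bound (suc k) ℚ.≤ bound k
    bound-step k = begin
      alpha f (suc k) ℚ.+ (term f (suc (suc k)) ℚ.+ term f (suc (suc k)))
        ≤⟨ ℚₚ.+-monoʳ-≤ (alpha f (suc k)) (term-halving (suc k)) ⟩
      alpha f k ℚ.+ term f (suc k) ℚ.+ term f (suc k)
        ≡⟨ ℚₚ.+-assoc (alpha f k) (term f (suc k)) (term f (suc k)) ⟩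
      bound k ∎
      where open ℚₚ.≤-Reasoning
    bound-antitone : ∀ {i j} → i ≤ j → bound j ℚ.≤ bound i
    bound-antitone = suc-mono⇒mono (flip ℚ._≤_) ℚₚ.≤-refl (flip ℚₚ.≤-trans) bound bound-step
    alpha<bound : alpha f m ℚ.< bound m
    alpha<bound = 0<q⇒p<p+q (ℚₚ.+-mono-< (term-pos f (suc m)) (term-pos f (suc m)))

  ↧ₙ-alphaᵘ≤ : ∀ n → ↧ₙ alphaᵘ f n ≤ E f n ^ suc n
  ↧ₙ-alphaᵘ≤ zero = begin
    ↧ₙ termᵘ f 0  ≡⟨ ↧ₙ-/ (+ 1) (E f 0) {{E-nonZero f 0}} ⟩
    E f 0         ≡⟨ *-identityʳ (E f 0) ⟨
    E f 0 ^ 1     ∎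
    where open ≤-Reasoning
  ↧ₙ-alphaᵘ≤ (suc n) = begin
    ↧ₙ alphaᵘ f (suc n)                 ≡⟨ ↧ₙ-+ (alphaᵘ f n) (termᵘ f (suc n)) ⟩
    ↧ₙ alphaᵘ f n * ↧ₙ termᵘ f (suc n)  ≡⟨ cong (↧ₙ alphaᵘ f n *_) ↧ₙ-termᵘ ⟩
    ↧ₙ alphaᵘ f n * E f (suc n)         ≤⟨ *-monoˡ-≤ (E f (suc n)) (↧ₙ-alphaᵘ≤ n) ⟩
    E f n ^ suc n * E f (suc n)
      ≤⟨ *-monoˡ-≤ (E f (suc n)) (^-monoˡ-≤ (suc n) (E-mono f-step (n≤1+n n))) ⟩
    E f (suc n) ^ suc n * E f (suc n)   ≡⟨ *-comm (E f (suc n) ^ suc n) (E f (suc n)) ⟩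
    E f (suc n) ^ suc (suc n)           ∎
    where
    open ≤-Reasoning
    ↧ₙ-termᵘ : ↧ₙ termᵘ f (suc n) ≡ E f (suc n)
    ↧ₙ-termᵘ = ↧ₙ-/ (+ 1) (E f (suc n)) {{E-nonZero f (suc n)}}

alpha-bracket⇒E[1+n]≤2*↧ₙ*↧ₙ : ∀ f n r → alpha f n ℚ.< r →
                                r ℚ.≤ alpha f n ℚ.+ (term f (suc n) ℚ.+ term f (suc n)) →
                                E f (suc n) ≤ 2 * ℚ.↧ₙ r * ↧ₙ alphaᵘ f n
alpha-bracket⇒E[1+n]≤2*↧ₙ*↧ₙ f n r@(mkℚ _ _ _) below above =
  <∧-≤2/⇒≤2*↧ₙ*↧ₙ (E f (suc n)) belowᵘ aboveᵘ
  where
  instance _ = E-nonZero f (suc n)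
  t = term f (suc n)
  tᵘ = termᵘ f (suc n)
  belowᵘ : alphaᵘ f n ℚᵘ.< toℚᵘ r
  belowᵘ = ℚᵘₚ.<-respˡ-≃ (toℚᵘ-alpha f n) (ℚₚ.toℚᵘ-mono-< below)
  aboveᵘ : toℚᵘ r ℚᵘ.- alphaᵘ f n ℚᵘ.≤ + 2 ℚᵘ./ E f (suc n)
  aboveᵘ = begin
    toℚᵘ r ℚᵘ.- alphaᵘ f n
      ≤⟨ ℚᵘₚ.+-monoˡ-≤ (ℚᵘ.- alphaᵘ f n) (ℚₚ.toℚᵘ-mono-≤ above) ⟩
    toℚᵘ (alpha f n ℚ.+ (t ℚ.+ t)) ℚᵘ.- alphaᵘ f n
      ≃⟨ ℚᵘₚ.+-congˡ (ℚᵘ.- alphaᵘ f n) toℚᵘ-sum ⟩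
    alphaᵘ f n ℚᵘ.+ (tᵘ ℚᵘ.+ tᵘ) ℚᵘ.- alphaᵘ f n
      ≃⟨ solve 2 (λ a b → a :+ b :- a := b) ℚᵘₚ.≃-refl (alphaᵘ f n) (tᵘ ℚᵘ.+ tᵘ) ⟩
    tᵘ ℚᵘ.+ tᵘ
      ≃⟨ 1/d+1/d≃2/d (E f (suc n)) ⟩
    + 2 ℚᵘ./ E f (suc n) ∎
    where
    open ℚᵘₚ.≤-Reasoning
    open ℚᵘ-Solver.+-*-Solver using (solve; _:+_; _:-_; _:=_)
    toℚᵘ-t : toℚᵘ t ℚᵘ.≃ tᵘ
    toℚᵘ-t = toℚᵘ-/ (+ 1) (E f (suc n))
    toℚᵘ-sum : toℚᵘ (alpha f n ℚ.+ (t ℚ.+ t)) ℚᵘ.≃ alphaᵘ f n ℚᵘ.+ (tᵘ ℚᵘ.+ tᵘ)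
    toℚᵘ-sum = ℚᵘₚ.≃-trans (ℚₚ.toℚᵘ-homo-+ (alpha f n) (t ℚ.+ t))
                 (ℚᵘₚ.+-cong (toℚᵘ-alpha f n)
                   (ℚᵘₚ.≃-trans (ℚₚ.toℚᵘ-homo-+ t t) (ℚᵘₚ.+-cong toℚᵘ-t toℚᵘ-t)))

lemma1 : (f : ℕ → ℕ) → Honest f → (r : ℚ) → ¬ ConvergesTo (alpha f) r
lemma1 f honest r α→r = <⇒≱ (2*n*E^[1+n]<E[1+n] f-step n) (begin
  E f (suc n)               ≤⟨ alpha-bracket⇒E[1+n]≤2*↧ₙ*↧ₙ f n r below above ⟩
  2 * n * ↧ₙ alphaᵘ f n     ≤⟨ *-monoʳ-≤ (2 * n) (↧ₙ-alphaᵘ≤ f-step n) ⟩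
  2 * n * E f n ^ suc n     ∎)
  where
  open ≤-Reasoning
  f-step = Honest.mono honest
  n = ℚ.↧ₙ r
  below : alpha f n ℚ.< r
  below = ℚₚ.<-≤-trans (alpha-< f n) (limit-≥ α→r (suc n) (λ _ → alpha-mono f))
  above : r ℚ.≤ alpha f n ℚ.+ (term f (suc n) ℚ.+ term f (suc n))
  above = limit-≤ α→r n (λ _ → alpha-tail f-step)
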